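{- Let $0\le p'\le N$ and let $P\subset Q$ be parabolic subgroups of $G$ containing $M_0$. Then $$(P\cap M_Q\cap S_{p'})(F)=\mathrm{Int}_\theta(N_P^Q(F))\big((M_P\cap S_{p'})(F)\big),$$ where $\mathrm{Int}_\theta(g)(s)=g\,s\,\theta g^{ -1}\theta$.
   Context: $F$ is a field of characteristic $0$, $D$ a central division algebra over $F$, $N=p+q$, $V=D^N$ with $D$-basis $e_1,\dots,e_p,f_1,\dots,f_q$, $G=GL_D(V)\cong GL_{N,D}$, $\theta=\mathrm{diag}(I_p,-I_q)$. For $0\le p'\le N$, $q'=N-p'$, $\theta_{p'}=\mathrm{diag}(I_{p'},-I_{q'})$, and $S_{p'}=\{g\theta_{p'}g^{ -1}\theta:g\in G\}$. $M_0$ is the diagonal subgroup. For a parabolic $P\supset M_0$, $M_P$ is its Levi factor containing $M_0$ and $N_P$ its unipotent radical; $N_P^Q=N_P\cap M_Q$. -}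

module Defs where

open import Level using (Level; _⊔_)
open import Data.Nat using (ℕ; zero; suc; _<_; _<?_)
open import Data.Fin as Fin using (Fin; toℕ; _≟_)
open import Relation.Nullary using (yes; no)
open import Data.Product using (Σ; ∃; _×_; _,_)
open import Relation.Nullary using (¬_)
open import Relation.Binary.PropositionalEquality using (_≡_; _≢_)
open import Algebra.Bundles using (Ring)

module _ {c ℓ : Level} (R : Ring c ℓ) where
  open Ring R

  natCast : ℕ → Carrier
  natCast zero    = 0#
  natCast (suc n) = 1# + natCast n

  sumFin : (k : ℕ) → (Fin k → Carrier) → Carrier
  sumFin zero    f = 0#
  sumFin (suc k) f = f Fin.zero + sumFin k (λ i → f (Fin.suc i))

  Central : Carrier → Set (c ⊔ ℓ)
  Central x = ∀ y → x * y ≈ y * x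

  -- D is a division ring, finite-dimensional over its center F,
  -- and F has characteristic 0.  (F := Z(D), so D is central over F.)
  record IsCentralDivAlgChar0 : Set (c ⊔ ℓ) where
    field
      nontrivial : ¬ (1# ≈ 0#)
      inverses   : ∀ x → ¬ (x ≈ 0#) → Σ Carrier (λ y → (x * y ≈ 1#) × (y * x ≈ 1#))
      finiteDim  : Σ ℕ (λ k → Σ (Fin k → Carrier) (λ b →
                     ∀ x → Σ (Fin k → Carrier) (λ a →
                       (∀ i → Central (a i)) × (x ≈ sumFin k (λ i → a i * b i)))))
      charZero   : ∀ n → ¬ (natCast (suc n) ≈ 0#)

  Mat : ℕ → Set c
  Mat N = Fin N → Fin N → Carrier

  module _ {N : ℕ} where
    _≈M_ : Mat N → Mat N → Set ℓ
    A ≈M B = ∀ i j → A i j ≈ B i j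

    _*M_ : Mat N → Mat N → Mat N
    (A *M B) i j = sumFin N (λ k → A i k * B k j)

    δ : Fin N → Fin N → Carrier
    δ i j with i ≟ j
    ... | yes _ = 1#
    ... | no  _ = 0#

    I : Mat N
    I = δ

    IsInverse : Mat N → Mat N → Set ℓ
    IsInverse g g' = ((g *M g') ≈M I) × ((g' *M g) ≈M I)

    -- g ∈ G(F) = GL_N(D)
    InG : Mat N → Set (c ⊔ ℓ)
    InG g = Σ (Mat N) (λ g' → IsInverse g g')

    thetaMat : ℕ → Mat N
    thetaMat p' i j with toℕ i <? p'
    ... | yes _ = δ i j
    ... | no  _ = - δ i j

    InS : (p p' : ℕ) → Mat N → Set (c ⊔ ℓ)
    InS p p' x = Σ (Mat N) (λ g → Σ (Mat N) (λ g' →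
                   IsInverse g g' × (x ≈M (((g *M thetaMat p') *M g') *M thetaMat p))))

    -- Parabolic subgroups containing M₀ = stabilisers of flags of coordinate
    -- subspaces; such a flag is encoded by a level function f : Fin N → ℕ
    -- (V_m = span of basis vectors of level ≤ m).
    Level' : Set
    Level' = Fin N → ℕ

    InPpat : Level' → Mat N → Set ℓ
    InPpat f g = ∀ i j → f j < f i → g i j ≈ 0#

    InP : Level' → Mat N → Set (c ⊔ ℓ)
    InP f g = InG g × InPpat f g

    InM : Level' → Mat N → Set (c ⊔ ℓ)
    InM f g = InG g × (∀ i j → f i ≢ f j → g i j ≈ 0#)

    InNpat : Level' → Mat N → Set ℓ
    InNpat f g = InPpat f g × (∀ i j → f i ≡ f j → g i j ≈ δ i j)

    _⊆P_ : Level' → Level' → Set (c ⊔ ℓ)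
    f ⊆P h = ∀ g → InP f g → InP h g

    -- Int_θ(n)(s) = n s θ n⁻¹ θ, with n⁻¹ = n'
    IntTheta : (p : ℕ) → Mat N → Mat N → Mat N → Mat N
    IntTheta p n n' s = ((n *M s) *M thetaMat p) *M (n' *M thetaMat p)

module Submission where

-- Put y = xθ. As x ∈ S_{p'}, y is conjugate to θ_{p'}, so y² = 1; as x ∈ P, so is y, and its Levi
-- component m is again an involution. For two involutions, n = ½(1 + ym) satisfies yn = nm; its
-- diagonal blocks are ½(1 + m²) = 1, so n ∈ N_P, and n ∈ M_Q because y and m are block diagonal
-- for Q. Then y = nmn⁻¹, i.e. x = Int_θ(n)(mθ) with mθ ∈ M_P ∩ S_{p'}. Conversely Int_θ(n)(s) stays
-- in S_{p'}, and in P ∩ M_Q since n⁻¹ = Σ_k (1 - n)^k does. Block diagonality passes from P to Q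
-- because P ⊆ Q forces the blocks of P to refine those of Q, as transvections inside a block show.

open import Defs
open import Level using (Level)
open import Data.Nat as ℕ using (ℕ; zero; suc; _<_; _≤_; _⊔_; _<?_)
import Data.Nat.Properties as ℕ
open import Data.Fin using (Fin; toℕ; _≟_; punchIn)
open import Data.Fin.Properties using (punchInᵢ≢i)
open import Data.Product using (Σ; _×_; _,_; proj₁; proj₂)
open import Data.Sum using (inj₁; inj₂)
open import Data.Empty using (⊥-elim)
open import Function using (_∘_)
open import Function.Bundles using (_⇔_; mk⇔)
open import Relation.Nullary using (¬_; yes; no)
open import Relation.Binary using (tri<; tri≈; tri>)
open import Relation.Binary.PropositionalEquality as ≡ using (_≡_; _≢_)
open import Algebra.Bundles using (Ring)
import Algebra.Properties.Monoid as MonoidProperties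
import Algebra.Properties.Ring as RingProperties
import Algebra.Properties.Semiring.Exp as Exp
import Algebra.Properties.Semiring.Sum as SumProperties
import Relation.Binary.Reasoning.Setoid as SetoidReasoning
open import Tactic.MonoidSolver using (solve)

module RingFacts {c ℓ : Level} (R : Ring c ℓ) where
  open Ring R
  open RingProperties R
  open MonoidProperties *-monoid using (cancelˡ; cancelʳ; insertʳ)
  open Exp semiring using (_^_)
  open SetoidReasoning setoid

  Inverse : Carrier → Carrier → Set ℓ
  Inverse a a' = (a * a' ≈ 1#) × (a' * a ≈ 1#)

  Invertible : Carrier → Set (c Level.⊔ ℓ)
  Invertible a = Σ Carrier (Inverse a)

  inverse-sym : ∀ {a a'} → Inverse a a' → Inverse a' a
  inverse-sym (aa' , a'a) = a'a , aa'

  inverse-cong : ∀ {a b a'} → a ≈ b → Inverse a a' → Inverse b a'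
  inverse-cong a≈b (aa' , a'a) = trans (*-congʳ (sym a≈b)) aa' , trans (*-congˡ (sym a≈b)) a'a

  inverse-* : ∀ {a a' b b'} → Inverse a a' → Inverse b b' → Inverse (a * b) (b' * a')
  inverse-* {a} {a'} {b} {b'} (aa' , a'a) (bb' , b'b) = cancel a a' b b' aa' bb' , cancel b' b a' a b'b a'a
    where
    cancel : ∀ u u' v v' → u * u' ≈ 1# → v * v' ≈ 1# → (u * v) * (v' * u') ≈ 1#
    cancel u u' v v' uu' vv' = begin
      (u * v) * (v' * u') ≈⟨ solve *-monoid ⟩
      u * ((v * v') * u') ≈⟨ *-congˡ (*-congʳ vv') ⟩
      u * (1# * u')       ≈⟨ *-congˡ (*-identityˡ u') ⟩
      u * u'              ≈⟨ uu' ⟩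
      1# ∎

  inverse-unique : ∀ {a a' b} → a' * a ≈ 1# → a * b ≈ 1# → a' ≈ b
  inverse-unique {a} {a'} {b} a'a ab = begin
    a'            ≈⟨ *-identityʳ a' ⟨
    a' * 1#       ≈⟨ *-congˡ ab ⟨
    a' * (a * b)  ≈⟨ *-assoc _ _ _ ⟨
    (a' * a) * b  ≈⟨ *-congʳ a'a ⟩
    1# * b        ≈⟨ *-identityˡ b ⟩
    b ∎

  natCast-central : ∀ n → Central R (natCast R n)
  natCast-central zero    y = trans (zeroˡ y) (sym (zeroʳ y))
  natCast-central (suc n) y = begin
    (1# + natCast R n) * y     ≈⟨ distribʳ y 1# _ ⟩
    1# * y + natCast R n * y   ≈⟨ +-cong (*-identityˡ y) (natCast-central n y) ⟩
    y + y * natCast R n        ≈⟨ +-congʳ (*-identityʳ y) ⟨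
    y * 1# + y * natCast R n   ≈⟨ distribˡ y 1# _ ⟨
    y * (1# + natCast R n) ∎

  inverse-central : ∀ {a a'} → Inverse a a' → Central R a → Central R a'
  inverse-central {a} {a'} (aa' , a'a) a-central y = begin
    a' * y              ≈⟨ insertʳ aa' (a' * y) ⟩
    ((a' * y) * a) * a' ≈⟨ *-congʳ (*-assoc a' y a) ⟩
    (a' * (y * a)) * a' ≈⟨ *-congʳ (*-congˡ (a-central y)) ⟨
    (a' * (a * y)) * a' ≈⟨ *-congʳ (cancelˡ a'a y) ⟩
    y * a' ∎

  halve : ∀ {h} → h * natCast R 2 ≈ 1# → ∀ a → h * (a + a) ≈ a
  halve {h} h2≈1 a = begin
    h * (a + a)            ≈⟨ *-congˡ 2a≈a+a ⟨
    h * (natCast R 2 * a)  ≈⟨ *-assoc _ _ _ ⟨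
    (h * natCast R 2) * a  ≈⟨ *-congʳ h2≈1 ⟩
    1# * a                 ≈⟨ *-identityˡ a ⟩
    a ∎
    where
    2a≈a+a : (1# + (1# + 0#)) * a ≈ a + a
    2a≈a+a = begin
      (1# + (1# + 0#)) * a         ≈⟨ distribʳ a 1# _ ⟩
      1# * a + (1# + 0#) * a       ≈⟨ +-cong (*-identityˡ a) (*-congʳ (+-identityʳ 1#)) ⟩
      a + 1# * a                   ≈⟨ +-congˡ (*-identityˡ a) ⟩
      a + a ∎

  geometricSum : ℕ → Carrier → Carrier
  geometricSum zero    e = 0#
  geometricSum (suc k) e = 1# + e * geometricSum k e

  geometricSum-closed : ∀ {p} (P : Carrier → Set p) → P 0# → P 1# →
    (∀ {a b} → P a → P b → P (a + b)) → (∀ {a b} → P a → P b → P (a * b)) →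
    ∀ k {e} → P e → P (geometricSum k e)
  geometricSum-closed P P0 P1 P+ P* zero    Pe = P0
  geometricSum-closed P P0 P1 P+ P* (suc k) Pe = P+ P1 (P* Pe (geometricSum-closed P P0 P1 P+ P* k Pe))

  1-e+e[1-f]≈1-ef : ∀ e f → (1# - e) + e * (1# - f) ≈ 1# - e * f
  1-e+e[1-f]≈1-ef e f = begin
    (1# - e) + e * (1# - f)       ≈⟨ +-congˡ (x[y-z]≈xy-xz e 1# f) ⟩
    (1# - e) + (e * 1# - e * f)   ≈⟨ +-congˡ (+-congʳ (*-identityʳ e)) ⟩
    (1# - e) + (e - e * f)        ≈⟨ +-assoc _ _ _ ⟩
    1# + (- e + (e - e * f))      ≈⟨ +-congˡ (+-assoc _ _ _) ⟨
    1# + ((- e + e) - e * f)      ≈⟨ +-congˡ (+-congʳ (-‿inverseˡ e)) ⟩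
    1# + (0# - e * f)             ≈⟨ +-congˡ (+-identityˡ _) ⟩
    1# - e * f ∎

  [1-e]*geometricSum : ∀ k e → (1# - e) * geometricSum k e ≈ 1# - e ^ k
  [1-e]*geometricSum zero    e = trans (zeroʳ _) (sym (-‿inverseʳ 1#))
  [1-e]*geometricSum (suc k) e = begin
    (1# - e) * (1# + e * G)        ≈⟨ distribˡ _ _ _ ⟩
    (1# - e) * 1# + (1# - e) * (e * G) ≈⟨ +-cong (*-identityʳ _) (sym (*-assoc _ _ _)) ⟩
    (1# - e) + ((1# - e) * e) * G  ≈⟨ +-congˡ (*-congʳ commutes) ⟩
    (1# - e) + (e * (1# - e)) * G  ≈⟨ +-congˡ (*-assoc _ _ _) ⟩
    (1# - e) + e * ((1# - e) * G)  ≈⟨ +-congˡ (*-congˡ ([1-e]*geometricSum k e)) ⟩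
    (1# - e) + e * (1# - e ^ k)    ≈⟨ 1-e+e[1-f]≈1-ef e (e ^ k) ⟩
    1# - e ^ suc k ∎
    where
    G = geometricSum k e
    commutes : (1# - e) * e ≈ e * (1# - e)
    commutes = begin
      (1# - e) * e    ≈⟨ [y-z]x≈yx-zx e 1# e ⟩
      1# * e - e * e  ≈⟨ +-congʳ (trans (*-identityˡ e) (sym (*-identityʳ e))) ⟩
      e * 1# - e * e  ≈⟨ x[y-z]≈xy-xz e 1# e ⟨
      e * (1# - e) ∎

  geometricSum*[1-e] : ∀ k e → geometricSum k e * (1# - e) ≈ 1# - e ^ k
  geometricSum*[1-e] zero    e = trans (zeroˡ _) (sym (-‿inverseʳ 1#))
  geometricSum*[1-e] (suc k) e = begin
    (1# + e * G) * (1# - e)        ≈⟨ distribʳ _ _ _ ⟩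
    1# * (1# - e) + (e * G) * (1# - e) ≈⟨ +-cong (*-identityˡ _) (*-assoc _ _ _) ⟩
    (1# - e) + e * (G * (1# - e))  ≈⟨ +-congˡ (*-congˡ (geometricSum*[1-e] k e)) ⟩
    (1# - e) + e * (1# - e ^ k)    ≈⟨ 1-e+e[1-f]≈1-ef e (e ^ k) ⟩
    1# - e ^ suc k ∎
    where G = geometricSum k e

  1-nilpotent-inverse : ∀ k e → e ^ k ≈ 0# → Inverse (1# - e) (geometricSum k e)
  1-nilpotent-inverse k e nil =
    trans ([1-e]*geometricSum k e) 1-0≈1 , trans (geometricSum*[1-e] k e) 1-0≈1
    where 1-0≈1 = trans (+-congˡ (trans (-‿cong nil) -0#≈0#)) (+-identityʳ 1#)

  1-[1-a]≈a : ∀ a → 1# - (1# - a) ≈ a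
  1-[1-a]≈a a = begin
    1# - (1# - a)      ≈⟨ +-congˡ (-‿+-comm 1# (- a)) ⟨
    1# + (- 1# - - a)  ≈⟨ +-congˡ (+-congˡ (-‿involutive a)) ⟩
    1# + (- 1# + a)    ≈⟨ +-assoc _ _ _ ⟨
    (1# - 1#) + a      ≈⟨ +-congʳ (-‿inverseʳ 1#) ⟩
    0# + a             ≈⟨ +-identityˡ a ⟩
    a ∎

  -- In the matrix ring with θ = θ_p and θ' = θ_{p'}, TwistedConj is membership in S_{p'} and intθ is Int_θ.
  module TwistedConjugation (θ θ' : Carrier) (θ²≈1 : θ * θ ≈ 1#) where

    TwistedConj : Carrier → Set (c Level.⊔ ℓ)
    TwistedConj x = Σ Carrier λ g → Σ Carrier λ g' → Inverse g g' × x ≈ ((g * θ') * g') * θ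

    intθ : Carrier → Carrier → Carrier → Carrier
    intθ n n' s = ((n * s) * θ) * (n' * θ)

    untwist : ∀ {x g g'} → x ≈ ((g * θ') * g') * θ → x * θ ≈ (g * θ') * g'
    untwist x≈ = trans (*-congʳ x≈) (cancelʳ θ²≈1 _)

    intθ-closed : ∀ {p} (P : Carrier → Set p) → (∀ {a b} → P a → P b → P (a * b)) →
      P θ → ∀ {n n' s} → P n → P n' → P s → P (intθ n n' s)
    intθ-closed P P* Pθ Pn Pn' Ps = P* (P* (P* Pn Ps) Pθ) (P* Pn' Pθ)

    intθ-invertible : ∀ {n n' s} → Inverse n n' → Invertible s → Invertible (intθ n n' s)
    intθ-invertible n⁻¹ (_ , s⁻¹) =
      _ , inverse-* (inverse-* (inverse-* n⁻¹ s⁻¹) θ⁻¹) (inverse-* (inverse-sym n⁻¹) θ⁻¹)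
      where θ⁻¹ = θ²≈1 , θ²≈1

    twistedConj-intθ : ∀ {n n' s x} → Inverse n n' → TwistedConj s → x ≈ intθ n n' s →
                       TwistedConj x
    twistedConj-intθ {n} {n'} {s} {x} n⁻¹ (g , g' , g⁻¹ , s≈) x≈ =
      n * g , g' * n' , inverse-* n⁻¹ g⁻¹ , (begin
        x                                             ≈⟨ x≈ ⟩
        ((n * s) * θ) * (n' * θ)                      ≈⟨ *-congʳ (*-congʳ (*-congˡ s≈)) ⟩
        ((n * (((g * θ') * g') * θ)) * θ) * (n' * θ)  ≈⟨ solve *-monoid ⟩
        (n * g) * θ' * g' * (θ * θ) * (n' * θ)        ≈⟨ *-congʳ (*-congˡ θ²≈1) ⟩
        (n * g) * θ' * g' * 1# * (n' * θ)             ≈⟨ solve *-monoid ⟩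
        (((n * g) * θ') * (g' * n')) * θ ∎)

    twistedConj-involution : θ' * θ' ≈ 1# → ∀ {x} → TwistedConj x → (x * θ) * (x * θ) ≈ 1#
    twistedConj-involution θ'²≈1 {x} (g , g' , (gg' , g'g) , x≈) = begin
      (x * θ) * (x * θ)                 ≈⟨ *-cong (untwist x≈) (untwist x≈) ⟩
      ((g * θ') * g') * ((g * θ') * g') ≈⟨ solve *-monoid ⟩
      (g * θ') * ((g' * g) * (θ' * g')) ≈⟨ *-congˡ (*-congʳ g'g) ⟩
      (g * θ') * (1# * (θ' * g'))       ≈⟨ solve *-monoid ⟩
      g * ((θ' * θ') * g')              ≈⟨ *-congˡ (*-congʳ θ'²≈1) ⟩
      g * (1# * g')                     ≈⟨ *-congˡ (*-identityˡ g') ⟩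
      g * g'                            ≈⟨ gg' ⟩
      1# ∎

    intertwined-decomposition : ∀ {x n n' m} → TwistedConj x → Inverse n n' →
      (x * θ) * n ≈ n * m → x ≈ intθ n n' (m * θ) × TwistedConj (m * θ)
    intertwined-decomposition {x} {n} {n'} {m} (g , g' , g⁻¹ , x≈) (nn' , n'n) xθn≈nm =
      sym intθ≈x , n' * g , g' * n , inverse-* (n'n , nn') g⁻¹ , *-congʳ (sym m≈)
      where
      m≈ : ((n' * g) * θ') * (g' * n) ≈ m
      m≈ = begin
        ((n' * g) * θ') * (g' * n)   ≈⟨ solve *-monoid ⟩
        n' * (((g * θ') * g') * n)   ≈⟨ *-congˡ (*-congʳ (untwist x≈)) ⟨
        n' * ((x * θ) * n)           ≈⟨ *-congˡ xθn≈nm ⟩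
        n' * (n * m)                 ≈⟨ cancelˡ n'n m ⟩
        m ∎
      intθ≈x : intθ n n' (m * θ) ≈ x
      intθ≈x = begin
        ((n * (m * θ)) * θ) * (n' * θ)  ≈⟨ solve *-monoid ⟩
        (n * m) * ((θ * θ) * (n' * θ))  ≈⟨ *-congˡ (*-congʳ θ²≈1) ⟩
        (n * m) * (1# * (n' * θ))       ≈⟨ solve *-monoid ⟩
        ((n * m) * n') * θ              ≈⟨ *-congʳ (*-congʳ xθn≈nm) ⟨
        (((x * θ) * n) * n') * θ        ≈⟨ *-congʳ (cancelʳ nn' (x * θ)) ⟩
        (x * θ) * θ                     ≈⟨ cancelʳ θ²≈1 x ⟩
        x ∎

  involutions-intertwined : ∀ {d y m} → d * y ≈ y * d → y * y ≈ 1# → m * m ≈ 1# →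
    y * (d * (1# + y * m)) ≈ (d * (1# + y * m)) * m
  involutions-intertwined {d} {y} {m} dy≈yd yy≈1 mm≈1 = begin
    y * (d * (1# + y * m))      ≈⟨ *-assoc _ _ _ ⟨
    (y * d) * (1# + y * m)      ≈⟨ *-congʳ dy≈yd ⟨
    (d * y) * (1# + y * m)      ≈⟨ *-assoc _ _ _ ⟩
    d * (y * (1# + y * m))      ≈⟨ *-congˡ (distribˡ _ _ _) ⟩
    d * (y * 1# + y * (y * m))  ≈⟨ *-congˡ (+-cong (*-identityʳ y) (cancelˡ yy≈1 m)) ⟩
    d * (y + m)                 ≈⟨ *-congˡ (+-comm y m) ⟩
    d * (m + y)                 ≈⟨ *-congˡ (+-cong (*-identityˡ m) (cancelʳ mm≈1 y)) ⟨
    d * (1# * m + (y * m) * m)  ≈⟨ *-congˡ (distribʳ _ _ _) ⟨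
    d * ((1# + y * m) * m)      ≈⟨ *-assoc _ _ _ ⟨
    (d * (1# + y * m)) * m ∎

module Matrices {c ℓ : Level} (R : Ring c ℓ) (N : ℕ) where
  open Ring R
  open RingProperties R
  open SumProperties semiring
  open SetoidReasoning setoid

  sumFin≡sum : ∀ k (u : Fin k → Carrier) → sumFin R k u ≡ sum u
  sumFin≡sum zero    u = ≡.refl
  sumFin≡sum (suc k) u = ≡.cong (u Fin.zero +_) (sumFin≡sum k (u ∘ Fin.suc))

  sum-zero : ∀ {k} {u : Fin k → Carrier} → (∀ i → u i ≈ 0#) → sum u ≈ 0#
  sum-zero {k} u≈0 = trans (sum-cong-≋ u≈0) (sum-replicate-zero k)

  sum-single : ∀ {k} {u : Fin k → Carrier} i → (∀ j → j ≢ i → u j ≈ 0#) → sum u ≈ u i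
  sum-single {suc k} {u} i others≈0 = begin
    sum u                              ≈⟨ sum-remove u ⟩
    u i + sum (λ j → u (punchIn i j))  ≈⟨ +-congˡ (sum-zero (others≈0 _ ∘ punchInᵢ≢i i)) ⟩
    u i + 0#                           ≈⟨ +-identityʳ _ ⟩
    u i ∎

  Matrix : Set c
  Matrix = Mat R N

  infix  4 _≈ᴹ_
  infixl 7 _*ᴹ_
  infixl 6 _+ᴹ_

  _≈ᴹ_ : Matrix → Matrix → Set ℓ
  _≈ᴹ_ = _≈M_ R

  _*ᴹ_ : Matrix → Matrix → Matrix
  _*ᴹ_ = _*M_ R

  _+ᴹ_ : Matrix → Matrix → Matrix
  (A +ᴹ B) i j = A i j + B i j

  -ᴹ_ : Matrix → Matrix
  (-ᴹ A) i j = - A i j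

  1ᴹ : Matrix
  1ᴹ = I R

  *ᴹ-entry : ∀ A B i j → (A *ᴹ B) i j ≡ sum (λ k → A i k * B k j)
  *ᴹ-entry A B i j = sumFin≡sum N (λ k → A i k * B k j)

  δ-refl : ∀ (i : Fin N) → δ R i i ≈ 1#
  δ-refl i with i ≟ i
  ... | yes _ = refl
  ... | no i≢i = ⊥-elim (i≢i ≡.refl)

  δ-≢ : ∀ {i j : Fin N} → i ≢ j → δ R i j ≈ 0#
  δ-≢ {i} {j} i≢j with i ≟ j
  ... | yes i≡j = ⊥-elim (i≢j i≡j)
  ... | no _    = refl

  *ᴹ-cong : ∀ {A A' B B'} → A ≈ᴹ A' → B ≈ᴹ B' → (A *ᴹ B) ≈ᴹ (A' *ᴹ B')
  *ᴹ-cong {A} {A'} {B} {B'} A≈ B≈ i j = begin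
    (A *ᴹ B) i j                   ≡⟨ *ᴹ-entry A B i j ⟩
    sum (λ k → A i k * B k j)      ≈⟨ sum-cong-≋ (λ k → *-cong (A≈ i k) (B≈ k j)) ⟩
    sum (λ k → A' i k * B' k j)    ≡⟨ *ᴹ-entry A' B' i j ⟨
    (A' *ᴹ B') i j ∎

  *ᴹ-assoc : ∀ A B C → ((A *ᴹ B) *ᴹ C) ≈ᴹ (A *ᴹ (B *ᴹ C))
  *ᴹ-assoc A B C i j = begin
    ((A *ᴹ B) *ᴹ C) i j
      ≡⟨ *ᴹ-entry (A *ᴹ B) C i j ⟩
    sum (λ l → (A *ᴹ B) i l * C l j)
      ≡⟨ sum-cong-≗ (λ l → ≡.cong (_* C l j) (*ᴹ-entry A B i l)) ⟩
    sum (λ l → sum (λ k → A i k * B k l) * C l j)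
      ≈⟨ sum-cong-≋ (λ l → *-distribʳ-sum (C l j) (λ k → A i k * B k l)) ⟩
    sum (λ l → sum (λ k → (A i k * B k l) * C l j))
      ≈⟨ ∑-comm (λ l k → (A i k * B k l) * C l j) ⟩
    sum (λ k → sum (λ l → (A i k * B k l) * C l j))
      ≈⟨ sum-cong-≋ (λ k → sum-cong-≋ (λ l → *-assoc (A i k) (B k l) (C l j))) ⟩
    sum (λ k → sum (λ l → A i k * (B k l * C l j)))
      ≈⟨ sum-cong-≋ (λ k → *-distribˡ-sum (A i k) (λ l → B k l * C l j)) ⟨
    sum (λ k → A i k * sum (λ l → B k l * C l j))
      ≡⟨ sum-cong-≗ (λ k → ≡.cong (A i k *_) (*ᴹ-entry B C k j)) ⟨
    sum (λ k → A i k * (B *ᴹ C) k j)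
      ≡⟨ *ᴹ-entry A (B *ᴹ C) i j ⟨
    (A *ᴹ (B *ᴹ C)) i j ∎

  Diagonal : Matrix → Set ℓ
  Diagonal D = ∀ {i j} → i ≢ j → D i j ≈ 0#

  *ᴹ-diagonalˡ : ∀ {D} → Diagonal D → ∀ A i j → (D *ᴹ A) i j ≈ D i i * A i j
  *ᴹ-diagonalˡ {D} D-diagonal A i j = begin
    (D *ᴹ A) i j               ≡⟨ *ᴹ-entry D A i j ⟩
    sum (λ k → D i k * A k j)  ≈⟨ sum-single i (λ k k≢i → trans (*-congʳ (D-diagonal (k≢i ∘ ≡.sym))) (zeroˡ _))
                                 ⟩
    D i i * A i j ∎

  *ᴹ-diagonalʳ : ∀ {D} → Diagonal D → ∀ A i j → (A *ᴹ D) i j ≈ A i j * D j j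
  *ᴹ-diagonalʳ {D} D-diagonal A i j = begin
    (A *ᴹ D) i j               ≡⟨ *ᴹ-entry A D i j ⟩
    sum (λ k → A i k * D k j)  ≈⟨ sum-single j (λ k k≢j → trans (*-congˡ (D-diagonal k≢j)) (zeroʳ _)) ⟩
    A i j * D j j ∎

  *ᴹ-identityˡ : ∀ A → (1ᴹ *ᴹ A) ≈ᴹ A
  *ᴹ-identityˡ A i j = trans (*ᴹ-diagonalˡ δ-≢ A i j) (trans (*-congʳ (δ-refl i)) (*-identityˡ _))

  *ᴹ-identityʳ : ∀ A → (A *ᴹ 1ᴹ) ≈ᴹ A
  *ᴹ-identityʳ A i j = trans (*ᴹ-diagonalʳ δ-≢ A i j) (trans (*-congˡ (δ-refl j)) (*-identityʳ _))

  *ᴹ-distribˡ : ∀ A B C → (A *ᴹ (B +ᴹ C)) ≈ᴹ ((A *ᴹ B) +ᴹ (A *ᴹ C))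
  *ᴹ-distribˡ A B C i j = begin
    (A *ᴹ (B +ᴹ C)) i j
      ≡⟨ *ᴹ-entry A (B +ᴹ C) i j ⟩
    sum (λ k → A i k * (B k j + C k j))
      ≈⟨ sum-cong-≋ (λ k → distribˡ (A i k) (B k j) (C k j)) ⟩
    sum (λ k → A i k * B k j + A i k * C k j)
      ≈⟨ ∑-distrib-+ (λ k → A i k * B k j) _ ⟩
    sum (λ k → A i k * B k j) + sum (λ k → A i k * C k j)
      ≡⟨ ≡.cong₂ _+_ (*ᴹ-entry A B i j) (*ᴹ-entry A C i j) ⟨
    ((A *ᴹ B) +ᴹ (A *ᴹ C)) i j ∎

  *ᴹ-distribʳ : ∀ A B C → ((B +ᴹ C) *ᴹ A) ≈ᴹ ((B *ᴹ A) +ᴹ (C *ᴹ A))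
  *ᴹ-distribʳ A B C i j = begin
    ((B +ᴹ C) *ᴹ A) i j
      ≡⟨ *ᴹ-entry (B +ᴹ C) A i j ⟩
    sum (λ k → (B i k + C i k) * A k j)
      ≈⟨ sum-cong-≋ (λ k → distribʳ (A k j) (B i k) (C i k)) ⟩
    sum (λ k → B i k * A k j + C i k * A k j)
      ≈⟨ ∑-distrib-+ (λ k → B i k * A k j) _ ⟩
    sum (λ k → B i k * A k j) + sum (λ k → C i k * A k j)
      ≡⟨ ≡.cong₂ _+_ (*ᴹ-entry B A i j) (*ᴹ-entry C A i j) ⟨
    ((B *ᴹ A) +ᴹ (C *ᴹ A)) i j ∎

  matrixRing : Ring c ℓ
  matrixRing = record
    { Carrier = Matrix
    ; _≈_ = _≈ᴹ_
    ; _+_ = _+ᴹ_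
    ; _*_ = _*ᴹ_
    ; -_ = -ᴹ_
    ; 0# = λ _ _ → 0#
    ; 1# = 1ᴹ
    ; isRing = record
      { +-isAbelianGroup = record
        { isGroup = record
          { isMonoid = record
            { isSemigroup = record
              { isMagma = record
                { isEquivalence = record
                  { refl = λ i j → refl
                  ; sym = λ A≈B i j → sym (A≈B i j)
                  ; trans = λ A≈B B≈C i j → trans (A≈B i j) (B≈C i j) }
                ; ∙-cong = λ A≈ B≈ i j → +-cong (A≈ i j) (B≈ i j) }
              ; assoc = λ A B C i j → +-assoc _ _ _ }
            ; identity = (λ A i j → +-identityˡ _) , (λ A i j → +-identityʳ _) }
          ; inverse = (λ A i j → -‿inverseˡ _) , (λ A i j → -‿inverseʳ _)
          ; ⁻¹-cong = λ A≈ i j → -‿cong (A≈ i j) }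
        ; comm = λ A B i j → +-comm _ _ }
      ; *-cong = *ᴹ-cong
      ; *-assoc = *ᴹ-assoc
      ; *-identity = *ᴹ-identityˡ , *ᴹ-identityʳ
      ; distrib = *ᴹ-distribˡ , *ᴹ-distribʳ
      }
    }

  scalar : Carrier → Matrix
  scalar a i j = a * δ R i j

  scalar-diagonal : ∀ a → Diagonal (scalar a)
  scalar-diagonal a i≢j = trans (*-congˡ (δ-≢ i≢j)) (zeroʳ a)

  scalar-*ᴹ : ∀ a A i j → (scalar a *ᴹ A) i j ≈ a * A i j
  scalar-*ᴹ a A i j =
    trans (*ᴹ-diagonalˡ (scalar-diagonal a) A i j) (*-congʳ (trans (*-congˡ (δ-refl i)) (*-identityʳ a)))

  *ᴹ-scalar : ∀ a A i j → (A *ᴹ scalar a) i j ≈ A i j * a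
  *ᴹ-scalar a A i j =
    trans (*ᴹ-diagonalʳ (scalar-diagonal a) A i j) (*-congˡ (trans (*-congˡ (δ-refl j)) (*-identityʳ a)))

  scalar-comm : ∀ {a} → Central R a → ∀ A → (scalar a *ᴹ A) ≈ᴹ (A *ᴹ scalar a)
  scalar-comm {a} a-central A i j =
    trans (scalar-*ᴹ a A i j) (trans (a-central (A i j)) (sym (*ᴹ-scalar a A i j)))

  thetaMat-diagonal : ∀ p → Diagonal (thetaMat R p)
  thetaMat-diagonal p {i} i≢j with toℕ i <? p
  ... | yes _ = δ-≢ i≢j
  ... | no  _ = trans (-‿cong (δ-≢ i≢j)) -0#≈0#

  thetaMat-involution : ∀ p → (thetaMat R p *ᴹ thetaMat R p) ≈ᴹ 1ᴹ
  thetaMat-involution p i j = trans (*ᴹ-diagonalˡ (thetaMat-diagonal p) θ i j) diagonal-square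
    where
    θ = thetaMat R p
    diagonal-square : θ i i * θ i j ≈ δ R i j
    diagonal-square with toℕ i <? p
    ... | yes _ = trans (*-congʳ (δ-refl i)) (*-identityˡ _)
    ... | no  _ = begin
      - δ R i i * - δ R i j    ≈⟨ -‿distribˡ-* _ _ ⟨
      - (δ R i i * - δ R i j)  ≈⟨ -‿cong (-‿distribʳ-* _ _) ⟨
      - - (δ R i i * δ R i j)  ≈⟨ -‿involutive _ ⟩
      δ R i i * δ R i j        ≈⟨ trans (*-congʳ (δ-refl i)) (*-identityˡ _) ⟩
      δ R i j ∎

maxLevel : ∀ {N} → (Fin N → ℕ) → ℕ
maxLevel {zero}  f = 0
maxLevel {suc N} f = f Fin.zero ⊔ maxLevel (f ∘ Fin.suc)

level≤maxLevel : ∀ {N} (f : Fin N → ℕ) i → f i ≤ maxLevel f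
level≤maxLevel f Fin.zero    = ℕ.m≤m⊔n _ _
level≤maxLevel f (Fin.suc i) = ℕ.≤-trans (level≤maxLevel (f ∘ Fin.suc) i) (ℕ.m≤n⊔m _ _)

module Levels {c ℓ : Level} (R : Ring c ℓ) {N : ℕ} (f : Fin N → ℕ) where
  open Ring R
  open RingProperties R using (-0#≈0#)
  open SumProperties semiring using (sum; sum-cong-≋)
  open SetoidReasoning setoid
  open Matrices R N
  module M = Ring matrixRing
  open Exp (Ring.semiring matrixRing) using (_^_)
  open RingFacts matrixRing using (Inverse; inverse-cong; inverse-unique; 1-[1-a]≈a)
  open RingFacts matrixRing using (geometricSum; geometricSum-closed; 1-nilpotent-inverse)

  -- UpperBy 0 is the shape of P_f (InPpat), UpperBy 1 that of its strictly upper part, and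
  -- BlockDiagonal that of M_f.
  UpperBy : ℕ → Matrix → Set ℓ
  UpperBy k A = ∀ i j → f j < k ℕ.+ f i → A i j ≈ 0#

  BlockDiagonal : Matrix → Set ℓ
  BlockDiagonal A = ∀ i j → f i ≢ f j → A i j ≈ 0#

  upper-cong : ∀ {k A B} → A ≈ᴹ B → UpperBy k A → UpperBy k B
  upper-cong A≈B A-upper i j lt = trans (sym (A≈B i j)) (A-upper i j lt)

  blockDiagonal-cong : ∀ {A B} → A ≈ᴹ B → BlockDiagonal A → BlockDiagonal B
  blockDiagonal-cong A≈B A-block i j ne = trans (sym (A≈B i j)) (A-block i j ne)

  upper-weaken : ∀ {k k' A} → k ≤ k' → UpperBy k' A → UpperBy k A
  upper-weaken k≤k' A-upper i j lt = A-upper i j (ℕ.<-≤-trans lt (ℕ.+-monoˡ-≤ _ k≤k'))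

  blockDiagonal⇒upper : ∀ {A} → BlockDiagonal A → UpperBy 0 A
  blockDiagonal⇒upper A-block i j lt = A-block i j (λ fi≡fj → ℕ.<-irrefl (≡.sym fi≡fj) lt)

  upper-0 : ∀ {k} → UpperBy k M.0#
  upper-0 _ _ _ = refl

  upper-+ : ∀ {k A B} → UpperBy k A → UpperBy k B → UpperBy k (A M.+ B)
  upper-+ A-upper B-upper i j lt = trans (+-cong (A-upper i j lt) (B-upper i j lt)) (+-identityˡ 0#)

  upper-* : ∀ {a b A B} → UpperBy a A → UpperBy b B → UpperBy (a ℕ.+ b) (A M.* B)
  upper-* {a} {b} {A} {B} A-upper B-upper i j lt = begin
    (A M.* B) i j              ≡⟨ *ᴹ-entry A B i j ⟩
    sum (λ l → A i l * B l j)  ≈⟨ sum-zero term ⟩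
    0# ∎
    where
    term : ∀ l → A i l * B l j ≈ 0#
    term l with f l ℕ.<? a ℕ.+ f i
    ... | yes fl<a+fi = trans (*-congʳ (A-upper i l fl<a+fi)) (zeroˡ _)
    ... | no  fl≮a+fi = trans (*-congˡ (B-upper l j fj<b+fl)) (zeroʳ _)
      where
      regroup : (a ℕ.+ b) ℕ.+ f i ≡ b ℕ.+ (a ℕ.+ f i)
      regroup = ≡.trans (≡.cong (ℕ._+ f i) (ℕ.+-comm a b)) (ℕ.+-assoc b a (f i))
      fj<b+fl : f j < b ℕ.+ f l
      fj<b+fl = ℕ.<-≤-trans lt (ℕ.≤-trans (ℕ.≤-reflexive regroup) (ℕ.+-monoʳ-≤ b (ℕ.≮⇒≥ fl≮a+fi)))

  blockDiagonal-0 : BlockDiagonal M.0#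
  blockDiagonal-0 _ _ _ = refl

  blockDiagonal-+ : ∀ {A B} → BlockDiagonal A → BlockDiagonal B → BlockDiagonal (A M.+ B)
  blockDiagonal-+ A-block B-block i j ne = trans (+-cong (A-block i j ne) (B-block i j ne)) (+-identityˡ 0#)

  blockDiagonal-neg : ∀ {A} → BlockDiagonal A → BlockDiagonal (M.- A)
  blockDiagonal-neg A-block i j ne = trans (-‿cong (A-block i j ne)) -0#≈0#

  blockDiagonal-* : ∀ {A B} → BlockDiagonal A → BlockDiagonal B → BlockDiagonal (A M.* B)
  blockDiagonal-* {A} {B} A-block B-block i j fi≢fj = begin
    (A M.* B) i j              ≡⟨ *ᴹ-entry A B i j ⟩
    sum (λ l → A i l * B l j)  ≈⟨ sum-zero term ⟩
    0# ∎
    where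
    term : ∀ l → A i l * B l j ≈ 0#
    term l with f i ℕ.≟ f l
    ... | no  fi≢fl = trans (*-congʳ (A-block i l fi≢fl)) (zeroˡ _)
    ... | yes fi≡fl = trans (*-congˡ (B-block l j (fi≢fj ∘ ≡.trans fi≡fl))) (zeroʳ _)

  diagonal⇒blockDiagonal : ∀ {D} → Diagonal D → BlockDiagonal D
  diagonal⇒blockDiagonal D-diagonal i j fi≢fj = D-diagonal (fi≢fj ∘ ≡.cong f)

  blockDiagonal-1 : BlockDiagonal M.1#
  blockDiagonal-1 = diagonal⇒blockDiagonal δ-≢

  blockDiagonal-thetaMat : ∀ p → BlockDiagonal (thetaMat R p)
  blockDiagonal-thetaMat p = diagonal⇒blockDiagonal (thetaMat-diagonal p)

  upper-1 : UpperBy 0 M.1#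
  upper-1 = blockDiagonal⇒upper blockDiagonal-1

  upper-geometricSum : ∀ k {e} → UpperBy 0 e → UpperBy 0 (geometricSum k e)
  upper-geometricSum = geometricSum-closed (UpperBy 0) upper-0 upper-1 upper-+ upper-*

  blockDiagonal-geometricSum : ∀ k {e} → BlockDiagonal e → BlockDiagonal (geometricSum k e)
  blockDiagonal-geometricSum =
    geometricSum-closed BlockDiagonal blockDiagonal-0 blockDiagonal-1 blockDiagonal-+ blockDiagonal-*

  upper-^ : ∀ {e} → UpperBy 1 e → ∀ k → UpperBy k (e ^ k)
  upper-^ e-upper zero    = upper-1
  upper-^ e-upper (suc k) = upper-* e-upper (upper-^ e-upper k)

  nilpotencyIndex : ℕ
  nilpotencyIndex = suc (maxLevel f)

  strictlyUpper-nilpotent : ∀ {e} → UpperBy 1 e → e ^ nilpotencyIndex M.≈ M.0#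
  strictlyUpper-nilpotent e-upper i j =
    upper-^ e-upper nilpotencyIndex i j (ℕ.s≤s (ℕ.≤-trans (level≤maxLevel f j) (ℕ.m≤m+n _ _)))

  levi : Matrix → Matrix
  levi A i j with f i ℕ.≟ f j
  ... | yes _ = A i j
  ... | no  _ = 0#

  levi-blockDiagonal : ∀ A → BlockDiagonal (levi A)
  levi-blockDiagonal A i j fi≢fj with f i ℕ.≟ f j
  ... | yes fi≡fj = ⊥-elim (fi≢fj fi≡fj)
  ... | no  _     = refl

  levi-sameLevel : ∀ A {i j} → f i ≡ f j → levi A i j ≈ A i j
  levi-sameLevel A {i} {j} fi≡fj with f i ℕ.≟ f j
  ... | yes _     = refl
  ... | no fi≢fj = ⊥-elim (fi≢fj fi≡fj)

  levi-cong : ∀ {A B} → A ≈ᴹ B → levi A ≈ᴹ levi B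
  levi-cong A≈B i j with f i ℕ.≟ f j
  ... | yes _ = A≈B i j
  ... | no  _ = refl

  levi-of-blockDiagonal : ∀ {A} → BlockDiagonal A → levi A ≈ᴹ A
  levi-of-blockDiagonal A-block i j with f i ℕ.≟ f j
  ... | yes _     = refl
  ... | no fi≢fj = sym (A-block i j fi≢fj)

  levi-* : ∀ {A B} → UpperBy 0 A → UpperBy 0 B → levi (A M.* B) ≈ᴹ (levi A M.* levi B)
  levi-* {A} {B} A-upper B-upper i j with f i ℕ.≟ f j
  ... | no fi≢fj = sym (blockDiagonal-* (levi-blockDiagonal A) (levi-blockDiagonal B) i j fi≢fj)
  ... | yes fi≡fj = begin
    (A M.* B) i j                        ≡⟨ *ᴹ-entry A B i j ⟩
    sum (λ l → A i l * B l j)            ≈⟨ sum-cong-≋ term ⟩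
    sum (λ l → levi A i l * levi B l j)  ≡⟨ *ᴹ-entry (levi A) (levi B) i j ⟨
    (levi A M.* levi B) i j ∎
    where
    term : ∀ l → A i l * B l j ≈ levi A i l * levi B l j
    term l with f i ℕ.≟ f l | f l ℕ.≟ f j
    ... | yes _     | yes _     = refl
    ... | yes fi≡fl | no fl≢fj  = ⊥-elim (fl≢fj (≡.trans (≡.sym fi≡fl) fi≡fj))
    ... | no fi≢fl  | _         = trans offBlock (sym (zeroˡ _))
      where
      offBlock : A i l * B l j ≈ 0#
      offBlock with f l ℕ.<? f i
      ... | yes fl<fi = trans (*-congʳ (A-upper i l fl<fi)) (zeroˡ _)
      ... | no  fl≮fi = trans (*-congˡ (B-upper l j fj<fl)) (zeroʳ _)
        where
        fj<fl : f j < f l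
        fj<fl = ≡.subst (_< f l) fi≡fj (ℕ.≤∧≢⇒< (ℕ.≮⇒≥ fl≮fi) fi≢fl)

  levi-involution : ∀ {y} → UpperBy 0 y → (y M.* y) ≈ᴹ M.1# → (levi y M.* levi y) ≈ᴹ M.1#
  levi-involution {y} y-upper y²≈1 = M.trans (M.sym (levi-* y-upper y-upper))
    (M.trans (levi-cong y²≈1) (levi-of-blockDiagonal blockDiagonal-1))

  unipotent⇒strictlyUpper : ∀ {n} → InNpat R f n → UpperBy 1 (M.1# M.- n)
  unipotent⇒strictlyUpper (n-upper , n-diagonal) i j fj<1+fi with ℕ.m<1+n⇒m<n∨m≡n fj<1+fi
  ... | inj₁ fj<fi =
    trans (+-cong (upper-1 i j fj<fi) (trans (-‿cong (n-upper i j fj<fi)) -0#≈0#)) (+-identityˡ 0#)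
  ... | inj₂ fj≡fi = trans (+-congˡ (-‿cong (n-diagonal i j (≡.sym fj≡fi)))) (-‿inverseʳ _)

  unipotent-inverse : ∀ {n} → InNpat R f n → Inverse n (geometricSum nilpotencyIndex (M.1# M.- n))
  unipotent-inverse {n} n-unipotent = inverse-cong (1-[1-a]≈a n)
    (1-nilpotent-inverse nilpotencyIndex _ (strictlyUpper-nilpotent (unipotent⇒strictlyUpper n-unipotent)))

  unipotent-inverse-unique : ∀ {n n'} → InNpat R f n → n' M.* n ≈ᴹ M.1# →
    n' ≈ᴹ geometricSum nilpotencyIndex (M.1# M.- n)
  unipotent-inverse-unique n-unipotent n'n≈1 =
    inverse-unique n'n≈1 (proj₁ (unipotent-inverse n-unipotent))

  unipotent-inverse-upper : ∀ {n n'} → InNpat R f n → n' M.* n ≈ᴹ M.1# → UpperBy 0 n'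
  unipotent-inverse-upper n-unipotent n'n≈1 =
    upper-cong (M.sym (unipotent-inverse-unique n-unipotent n'n≈1))
    (upper-geometricSum nilpotencyIndex (upper-weaken ℕ.z≤n (unipotent⇒strictlyUpper n-unipotent)))

module Refinement {c ℓ : Level} (R : Ring c ℓ) (D-division : IsCentralDivAlgChar0 R)
                  {N : ℕ} (f h : Fin N → ℕ) (P-f⊆P-h : _⊆P_ R f h) where
  open Ring R
  open RingProperties R using (-0#≈0#; -‿involutive)
  open SumProperties semiring using (sum)
  open SetoidReasoning setoid
  open Matrices R N
  module M = Ring matrixRing
  open RingFacts matrixRing using (geometricSum; 1-nilpotent-inverse)
  open IsCentralDivAlgChar0 D-division using (nontrivial)
  module Lf = Levels R f
  module Lh = Levels R h

  elementary : Fin N → Fin N → Matrix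
  elementary a b k l = δ R k a * δ R b l

  elementary-square-zero : ∀ {a b} → a ≢ b → (elementary a b M.* elementary a b) ≈ᴹ M.0#
  elementary-square-zero {a} {b} a≢b k l = begin
    (E M.* E) k l               ≡⟨ *ᴹ-entry E E k l ⟩
    sum (λ m → E k m * E m l)   ≈⟨ sum-zero term ⟩
    0# ∎
    where
    E = elementary a b
    term : ∀ m → E k m * E m l ≈ 0#
    term m with b ≟ m
    ... | yes ≡.refl = trans (*-congˡ (trans (*-congʳ (δ-≢ (a≢b ∘ ≡.sym))) (zeroˡ _))) (zeroʳ _)
    ... | no  _      = trans (*-congʳ (zeroʳ _)) (zeroˡ _)

  -- The transvection 1 - E_ab lies in P_f, hence in P_h, which forbids h b < h a.
  level-order-preserved : ∀ {a b} → f a ≡ f b → ¬ (h b < h a)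
  level-order-preserved {a} {b} fa≡fb hb<ha = nontrivial 1≈0
    where
    a≢b : a ≢ b
    a≢b a≡b = ℕ.<-irrefl (≡.cong h (≡.sym a≡b)) hb<ha
    E = elementary a b
    T = M.1# M.- E
    T-invertible : InG R T
    T-invertible = geometricSum 2 E ,
      1-nilpotent-inverse 2 E (M.trans (M.*-congˡ (M.*-identityʳ E)) (elementary-square-zero a≢b))
    T-upper : InPpat R f T
    T-upper k l fl<fk = trans (+-cong (δ-≢ k≢l) (trans (-‿cong E-entry) -0#≈0#)) (+-identityˡ 0#)
      where
      k≢l : k ≢ l
      k≢l k≡l = ℕ.<-irrefl (≡.cong f (≡.sym k≡l)) fl<fk
      E-entry : E k l ≈ 0#
      E-entry with k ≟ a | b ≟ l
      ... | yes ≡.refl | yes ≡.refl = ⊥-elim (ℕ.<-irrefl (≡.sym fa≡fb) fl<fk)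
      ... | no _       | _          = zeroˡ _
      ... | yes _      | no _       = zeroʳ _
    -1≈0 : - 1# ≈ 0#
    -1≈0 = begin
      - 1#                         ≈⟨ +-identityˡ _ ⟨
      0# - 1#                      ≈⟨ +-congʳ (δ-≢ a≢b) ⟨
      δ R a b - 1#                 ≈⟨ +-congˡ (-‿cong (*-identityˡ 1#)) ⟨
      δ R a b - 1# * 1#            ≈⟨ +-congˡ (-‿cong (*-cong (δ-refl a) (δ-refl b))) ⟨
      δ R a b - δ R a a * δ R b b  ≈⟨ proj₂ (P-f⊆P-h T (T-invertible , T-upper)) a b hb<ha ⟩
      0# ∎
    1≈0 : 1# ≈ 0#
    1≈0 = trans (sym (-‿involutive 1#)) (trans (-‿cong -1≈0) -0#≈0#)

  levels-refine : ∀ {i j} → f i ≡ f j → h i ≡ h j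
  levels-refine {i} {j} fi≡fj with ℕ.<-cmp (h i) (h j)
  ... | tri< hi<hj _ _ = ⊥-elim (level-order-preserved (≡.sym fi≡fj) hi<hj)
  ... | tri≈ _ hi≡hj _ = hi≡hj
  ... | tri> _ _ hj<hi = ⊥-elim (level-order-preserved fi≡fj hj<hi)

  blockDiagonal-coarsen : ∀ {A} → Lf.BlockDiagonal A → Lh.BlockDiagonal A
  blockDiagonal-coarsen A-block i j hi≢hj = A-block i j (hi≢hj ∘ levels-refine)

module Decomposition {c ℓ : Level} (R : Ring c ℓ) (D-division : IsCentralDivAlgChar0 R)
                     {N : ℕ} (f h : Fin N → ℕ) (P-f⊆P-h : _⊆P_ R f h) (p p' : ℕ) where
  open Ring R
  open Matrices R N
  module M = Ring matrixRing
  open RingFacts matrixRing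
  module Scalar = RingFacts R
  module Lf = Levels R f
  module Lh = Levels R h
  open Refinement R D-division f h P-f⊆P-h using (blockDiagonal-coarsen)
  open IsCentralDivAlgChar0 D-division using (inverses; charZero)
  open SetoidReasoning setoid

  θ θ' : Matrix
  θ  = thetaMat R p
  θ' = thetaMat R p'

  open TwistedConjugation θ θ' (thetaMat-involution p)

  θ-inverse : Inverse θ θ
  θ-inverse = thetaMat-involution p , thetaMat-involution p

  unipotent-inverse-blockDiagonal : ∀ {n n'} → InNpat R f n → n' M.* n ≈ᴹ M.1# →
    Lh.BlockDiagonal n → Lh.BlockDiagonal n'
  unipotent-inverse-blockDiagonal n-unipotent n'n≈1 n-block =
    Lh.blockDiagonal-cong (M.sym (Lf.unipotent-inverse-unique n-unipotent n'n≈1))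
      (Lh.blockDiagonal-geometricSum Lf.nilpotencyIndex
        (Lh.blockDiagonal-+ Lh.blockDiagonal-1 (Lh.blockDiagonal-neg n-block)))

  LeftSide : Matrix → Set (c Level.⊔ ℓ)
  LeftSide x = InP R f x × InM R h x × TwistedConj x

  RightSide : Matrix → Set (c Level.⊔ ℓ)
  RightSide x = Σ Matrix λ n → Σ Matrix λ n' → Σ Matrix λ s →
    Inverse n n' × InNpat R f n × InM R h n × InM R f s × TwistedConj s × x ≈ᴹ intθ n n' s

  recompose : ∀ {x} → RightSide x → LeftSide x
  recompose {x} (n , n' , s , n⁻¹ , n-unipotent , (_ , n-block) , (s-invertible , s-block) ,
                 s-twisted , x≈) =
    (x-invertible , x-upper) , (x-invertible , x-block) , twistedConj-intθ n⁻¹ s-twisted x≈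
    where
    x-invertible : Invertible x
    x-invertible =
      let (x' , x⁻¹) = intθ-invertible n⁻¹ s-invertible in x' , inverse-cong (M.sym x≈) x⁻¹
    x-upper : Lf.UpperBy 0 x
    x-upper = Lf.upper-cong (M.sym x≈) (intθ-closed (Lf.UpperBy 0) Lf.upper-*
      (Lf.blockDiagonal⇒upper (Lf.blockDiagonal-thetaMat p)) (proj₁ n-unipotent)
      (Lf.unipotent-inverse-upper n-unipotent (proj₂ n⁻¹)) (Lf.blockDiagonal⇒upper s-block))
    x-block : Lh.BlockDiagonal x
    x-block = Lh.blockDiagonal-cong (M.sym x≈) (intθ-closed Lh.BlockDiagonal Lh.blockDiagonal-*
      (Lh.blockDiagonal-thetaMat p) n-block
      (unipotent-inverse-blockDiagonal n-unipotent (proj₂ n⁻¹) n-block) (blockDiagonal-coarsen s-block))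

  half : Carrier
  half = proj₁ (inverses (natCast R 2) (charZero 1))

  half-inverse : Scalar.Inverse (natCast R 2) half
  half-inverse = proj₂ (inverses (natCast R 2) (charZero 1))

  half-central : Central R half
  half-central = Scalar.inverse-central half-inverse (Scalar.natCast-central 2)

  module _ {x} (x-upper : InPpat R f x) (x-block : Lh.BlockDiagonal x) (x-twisted : TwistedConj x) where
    y : Matrix
    y = x M.* θ

    y-upper : Lf.UpperBy 0 y
    y-upper = Lf.upper-* x-upper (Lf.blockDiagonal⇒upper (Lf.blockDiagonal-thetaMat p))

    y-involution : y M.* y ≈ᴹ M.1#
    y-involution = twistedConj-involution (thetaMat-involution p') x-twisted

    m : Matrix
    m = Lf.levi y

    m-block : Lf.BlockDiagonal m
    m-block = Lf.levi-blockDiagonal y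

    m-involution : m M.* m ≈ᴹ M.1#
    m-involution = Lf.levi-involution y-upper y-involution

    -- The factor ½ makes the diagonal blocks of n equal to ½(1 + m²) = 1.
    n : Matrix
    n = scalar half M.* (M.1# M.+ y M.* m)

    n-unipotent : InNpat R f n
    n-unipotent = n-upper , n-diagonal
      where
      n-upper : Lf.UpperBy 0 n
      n-upper = Lf.upper-* (Lf.blockDiagonal⇒upper (Lf.diagonal⇒blockDiagonal (scalar-diagonal half)))
        (Lf.upper-+ Lf.upper-1 (Lf.upper-* y-upper (Lf.blockDiagonal⇒upper m-block)))
      n-diagonal : ∀ i j → f i ≡ f j → n i j ≈ δ R i j
      n-diagonal i j fi≡fj = begin
        n i j                            ≈⟨ scalar-*ᴹ half (M.1# M.+ y M.* m) i j ⟩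
        half * (δ R i j + (y M.* m) i j) ≈⟨ *-congˡ (+-congˡ ym≈δ) ⟩
        half * (δ R i j + δ R i j)       ≈⟨ Scalar.halve (proj₂ half-inverse) (δ R i j) ⟩
        δ R i j ∎
        where
        ym≈δ : (y M.* m) i j ≈ δ R i j
        ym≈δ = begin
          (y M.* m) i j              ≈⟨ Lf.levi-sameLevel (y M.* m) fi≡fj ⟨
          Lf.levi (y M.* m) i j      ≈⟨ Lf.levi-* {y} {m} y-upper (Lf.blockDiagonal⇒upper m-block) i j ⟩
          (m M.* Lf.levi m) i j      ≈⟨ M.*-congˡ {m} (Lf.levi-of-blockDiagonal m-block) i j ⟩
          (m M.* m) i j              ≈⟨ m-involution i j ⟩
          δ R i j ∎

    n' : Matrix
    n' = geometricSum Lf.nilpotencyIndex (M.1# M.- n)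

    n-inverse : Inverse n n'
    n-inverse = Lf.unipotent-inverse n-unipotent

    n-block : Lh.BlockDiagonal n
    n-block = Lh.blockDiagonal-* (Lh.diagonal⇒blockDiagonal (scalar-diagonal half))
      (Lh.blockDiagonal-+ Lh.blockDiagonal-1 (Lh.blockDiagonal-* y-block (blockDiagonal-coarsen m-block)))
      where y-block = Lh.blockDiagonal-* x-block (Lh.blockDiagonal-thetaMat p)

    n-intertwines : y M.* n ≈ᴹ n M.* m
    n-intertwines = involutions-intertwined (scalar-comm half-central y) y-involution m-involution

    s-block : Lf.BlockDiagonal (m M.* θ)
    s-block = Lf.blockDiagonal-* m-block (Lf.blockDiagonal-thetaMat p)

    s-inverse : Inverse (m M.* θ) (θ M.* m)
    s-inverse = inverse-* (m-involution , m-involution) θ-inverse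

    decomposition : RightSide x
    decomposition =
      let (x≈ , s-twisted) = intertwined-decomposition x-twisted n-inverse n-intertwines in
      n , n' , m M.* θ , n-inverse , n-unipotent , ((n' , n-inverse) , n-block) ,
      ((θ M.* m , s-inverse) , s-block) , s-twisted , x≈

  decompose : ∀ {x} → LeftSide x → RightSide x
  decompose ((_ , x-upper) , (_ , x-block) , x-twisted) = decomposition x-upper x-block x-twisted

  decomposition-iff : ∀ x → LeftSide x ⇔ RightSide x
  decomposition-iff x = mk⇔ decompose recompose

open import Data.Nat using (_+_)

mainTheorem14 : {c ℓ : Level} (D : Ring c ℓ) → IsCentralDivAlgChar0 D →
    (p q : ℕ) → let N = p + q in
    (p' : ℕ) → p' ≤ N →
    (f h : Level' D {N}) → _⊆P_ D f h →
    (x : Mat D N) →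
      ((InP D f x × InM D h x × InS D p p' x)
        ⇔ Σ (Mat D N) (λ n → Σ (Mat D N) (λ n' → Σ (Mat D N) (λ s →
            IsInverse D n n' × InNpat D f n × InM D h n ×
            InM D f s × InS D p p' s ×
            _≈M_ D x (IntTheta D p n n' s)))))
mainTheorem14 D D-division p q p' _ f h P-f⊆P-h =
  Decomposition.decomposition-iff D D-division f h P-f⊆P-h p p'
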